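{- Let $G=(V,E)$ be a simple, connected, undirected graph with $V=\{1,\ldots,n\}$ and family of maximal independent sets $\mathscr{M}$. If $G$ has a vertex $v$ such that the induced subgraph $G[V\setminus N[v]]$ has isolated vertices, then every $A\in\mathscr{M}$ with $v\in A$ satisfies $Int(A)\neq\emptyset$.
   Context: The labels give the linear order on $V$; $N(v)$ is the neighbourhood of $v$ and $N[v]=N(v)\cup\{v\}$. For an independent set $A$ and $u\in A$, $Subs(u)=\{w\in N(u): (A\setminus\{u\})\cup\{w\}\text{ independent}\}$; $u$ is internally active in $A$ if $Subs(u)=\emptyset$ or $u>\max Subs(u)$; $Int(A)$ is the set of internally active vertices of $A$. -}

module Defs where

open import Data.Nat using (ℕ; suc)
open import Data.Fin using (Fin; _<_; _≤_)
open import Data.Fin.Subset using (Subset; _∈_; _∉_; _⊆_; _∪_; _-_; ⁅_⁆)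
open import Data.Product using (Σ; ∃; _×_; _,_)
open import Data.Sum using (_⊎_)
open import Data.Empty using (⊥)
open import Relation.Nullary using (¬_; Dec)
open import Relation.Binary.PropositionalEquality using (_≡_)

-- A simple undirected graph on the vertex set Fin n (labels 0..n-1, ordered as in Fin,
-- corresponding to the paper's labels 1..n).
record Graph (n : ℕ) : Set₁ where
  field
    Adj     : Fin n → Fin n → Set
    adj?    : ∀ x y → Dec (Adj x y)
    sym     : ∀ {x y} → Adj x y → Adj y x
    irrefl  : ∀ {x} → ¬ Adj x x

module _ {n : ℕ} (G : Graph n) where
  open Graph G

  data Reach : Fin n → Fin n → Set where
    here  : ∀ {x} → Reach x x
    step  : ∀ {x y z} → Adj x y → Reach y z → Reach x z

  Connected : Set
  Connected = ∀ x y → Reach x y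

  InN : Fin n → Fin n → Set
  InN v w = Adj v w

  InNc : Fin n → Fin n → Set
  InNc v w = Adj v w ⊎ w ≡ v

  HasIsolatedOutsideClosedNbhd : Fin n → Set
  HasIsolatedOutsideClosedNbhd v =
    Σ (Fin n) λ w → ¬ InNc v w ×
      (∀ u → ¬ InNc v u → ¬ Adj w u)

  Independent : Subset n → Set
  Independent A = ∀ x y → x ∈ A → y ∈ A → ¬ Adj x y

  MaximalIndependent : Subset n → Set
  MaximalIndependent A = Independent A × (∀ B → Independent B → A ⊆ B → B ≡ A)

  InSubs : Subset n → Fin n → Fin n → Set
  InSubs A u w = InN u w × Independent ((A - u) ∪ ⁅ w ⁆)

  SubsEmpty : Subset n → Fin n → Set
  SubsEmpty A u = ∀ w → ¬ InSubs A u w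

  IsMaxSubs : Subset n → Fin n → Fin n → Set
  IsMaxSubs A u m = InSubs A u m × (∀ w → InSubs A u w → w ≤ m)

  InternallyActive : Subset n → Fin n → Set
  InternallyActive A u =
    SubsEmpty A u ⊎ (Σ (Fin n) λ m → IsMaxSubs A u m × m < u)

  InInt : Subset n → Fin n → Set
  InInt A u = u ∈ A × InternallyActive A u

module Submission where

open import Defs
open import Data.Nat using (ℕ)
open import Data.Fin using (Fin)
open import Data.Fin.Subset using (Subset; _∈_; _∪_; ⁅_⁆; _-_)
open import Data.Fin.Subset.Properties
  using (x∈p∪q⁻; x∈p∪q⁺; p⊆p∪q; x∈⁅y⁆⇒x≡y; x∈⁅x⁆; x∈p∧x≢y⇒x∈p-y)
open import Data.Product using (Σ; _,_)
open import Data.Sum using (inj₁; inj₂)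
open import Relation.Nullary using (¬_; yes; no; contradiction)
open import Relation.Binary.PropositionalEquality using (_≡_; refl; subst; sym)

-- A vertex w isolated in G[V ∖ N[v]] has N(w) ⊆ N(v). If v lies in a maximal
-- independent set A, then w has no neighbour in A, so maximality forces w ∈ A;
-- and no neighbour of w can replace it in A, as it would be adjacent to v ∈ A.
-- Thus Subs(w) = ∅ and w is internally active.

module _ {n : ℕ} (G : Graph n) where
  open Graph G renaming (sym to Adj-sym)

  isolatedOutside⇒N⊆N : ∀ {v w} → ¬ InNc G v w → (∀ u → ¬ InNc G v u → ¬ Adj w u) →
                        ∀ {y} → Adj w y → Adj v y
  isolatedOutside⇒N⊆N {v} {w} w∉N[v] isolated {y} w~y with adj? v y
  ... | yes v~y = v~y
  ... | no v≁y  = contradiction w~y (isolated y y∉N[v])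
    where
    y∉N[v] : ¬ InNc G v y
    y∉N[v] (inj₁ v~y) = v≁y v~y
    y∉N[v] (inj₂ refl) = w∉N[v] (inj₁ (Adj-sym w~y))

  independent-∪-⁅⁆ : ∀ {A x} → Independent G A → (∀ y → y ∈ A → ¬ Adj x y) →
                     Independent G (A ∪ ⁅ x ⁆)
  independent-∪-⁅⁆ {A} {x} indA x≁A y z y∈ z∈ with x∈p∪q⁻ A ⁅ x ⁆ y∈ | x∈p∪q⁻ A ⁅ x ⁆ z∈
  ... | inj₁ y∈A | inj₁ z∈A = indA y z y∈A z∈A
  ... | inj₁ y∈A | inj₂ z≡x rewrite x∈⁅y⁆⇒x≡y x z≡x = λ y~x → x≁A y y∈A (Adj-sym y~x)
  ... | inj₂ y≡x | inj₁ z∈A rewrite x∈⁅y⁆⇒x≡y x y≡x = x≁A z z∈A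
  ... | inj₂ y≡x | inj₂ z≡x rewrite x∈⁅y⁆⇒x≡y x y≡x | x∈⁅y⁆⇒x≡y x z≡x = irrefl

  maximal⇒noNeighbourIn⇒∈ : ∀ {A x} → MaximalIndependent G A →
                            (∀ y → y ∈ A → ¬ Adj x y) → x ∈ A
  maximal⇒noNeighbourIn⇒∈ {A} {x} (indA , maxA) x≁A =
    subst (x ∈_) (maxA (A ∪ ⁅ x ⁆) (independent-∪-⁅⁆ indA x≁A) (p⊆p∪q ⁅ x ⁆))
          (x∈p∪q⁺ (inj₂ (x∈⁅x⁆ x)))

  N⊆N⇒subsEmpty : ∀ {A u v} → v ∈ A → ¬ v ≡ u → (∀ {y} → Adj u y → Adj v y) →
                  SubsEmpty G A u
  N⊆N⇒subsEmpty v∈A v≢u Nu⊆Nv y (u~y , swapped-indep) =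
    swapped-indep _ y (x∈p∪q⁺ (inj₁ (x∈p∧x≢y⇒x∈p-y v∈A v≢u)))
                      (x∈p∪q⁺ (inj₂ (x∈⁅x⁆ y)))
                      (Nu⊆Nv u~y)

proposition2 : (n : ℕ) (G : Graph n) → Connected G →
    (v : Fin n) → HasIsolatedOutsideClosedNbhd G v →
    (A : Subset n) → MaximalIndependent G A → v ∈ A →
    Σ (Fin n) λ u → InInt G A u
proposition2 n G _ v (w , w∉N[v] , isolated) A maxA@(indA , _) v∈A =
  w , w∈A , inj₁ (N⊆N⇒subsEmpty G v∈A (λ v≡w → w∉N[v] (inj₂ (sym v≡w))) Nw⊆Nv)
  where
  Nw⊆Nv : ∀ {y} → Graph.Adj G w y → Graph.Adj G v y
  Nw⊆Nv = isolatedOutside⇒N⊆N G w∉N[v] isolated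

  w∈A : w ∈ A
  w∈A = maximal⇒noNeighbourIn⇒∈ G maxA (λ y y∈A w~y → indA v y v∈A y∈A (Nw⊆Nv w~y))
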